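{- Let $\mathcal{G}=(V,E)$ be a non-bipartite graph and $v_p\in V$ such that $\mathcal{G}\setminus v_p$ is bipartite. Then \[\chi^f(\mathcal{G})=2+\frac{1}{\rho-1},\] where $2\rho-1$ is the odd girth of $\mathcal{G}$.
   Context: $\mathcal{G}\setminus v_p$ deletes $v_p$ and its incident edges. The odd girth is the length of a shortest odd cycle. With $\mathcal{I}$ the set of independent sets of $\mathcal{G}$, the fractional chromatic number $\chi^f(\mathcal{G})$ is the optimal value of $\min\sum_{I\in\mathcal{I}}y_I$ subject to $\sum_{I\in\mathcal{I}: v\in I}y_I\ge1$ for all $v\in V$ and $y_I\ge0$ for all $I\in\mathcal{I}$.
   Formalization: The variables $y_I$ of the linear program defining $\chi^f(\mathcal{G})$ take rational values, so both the feasible witness and the lower bound range over rational solutions. -}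

module Defs where

open import Data.Bool using (Bool; true; false)
open import Data.Nat using (ℕ; zero; suc; _≤_)
open import Data.Fin using (Fin; zero; suc; inject₁; fromℕ; punchIn)
open import Data.Fin.Subset using (Subset; _∈_; inside; outside)
open import Data.Fin.Subset.Properties using (_∈?_)
open import Data.Vec using (_∷_; [])
open import Data.List using (List; []; _∷_; map; _++_; foldr)
open import Data.Empty using (⊥)
open import Data.Product using (Σ; _×_; _,_; ∃)
open import Data.Rational using (ℚ; 0ℚ; _+_) renaming (_≤_ to _≤ℚ_)
open import Relation.Nullary using (¬_; does)
open import Relation.Binary.PropositionalEquality using (_≡_; _≢_)
open import Function.Definitions using (Injective)

record Graph (n : ℕ) : Set where
  field
    adj     : Fin n → Fin n → Bool
    sym     : ∀ u v → adj u v ≡ adj v u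
    irrefl  : ∀ u → adj u u ≡ false
open Graph public

deleteVertex : ∀ {n} → Graph (suc n) → Fin (suc n) → Graph n
deleteVertex G p = record
  { adj    = λ u w → adj G (punchIn p u) (punchIn p w)
  ; sym    = λ u w → sym G (punchIn p u) (punchIn p w)
  ; irrefl = λ u → irrefl G (punchIn p u)
  }

Bipartite : ∀ {n} → Graph n → Set
Bipartite {n} G = Σ (Fin n → Bool) λ c → ∀ u v → adj G u v ≡ true → c u ≢ c v

-- A cycle of length suc m: distinct vertices c 0, …, c m with consecutive
-- vertices adjacent and c m adjacent to c 0, and length ≥ 3.
IsCycle : ∀ {n} → Graph n → (m : ℕ) → (Fin (suc m) → Fin n) → Set
IsCycle G m c =
  3 ≤ suc m ×
  Injective _≡_ _≡_ c ×
  (∀ (i : Fin m) → adj G (c (inject₁ i)) (c (suc i)) ≡ true) ×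
  adj G (c (fromℕ m)) (c zero) ≡ true

HasCycleOfLength : ∀ {n} → Graph n → ℕ → Set
HasCycleOfLength {n} G zero = ⊥
HasCycleOfLength {n} G (suc m) = ∃ λ (c : Fin (suc m) → Fin n) → IsCycle G m c

data Odd : ℕ → Set where
  odd1 : Odd 1
  oddSS : ∀ {k} → Odd k → Odd (suc (suc k))

IsOddGirth : ∀ {n} → Graph n → ℕ → Set
IsOddGirth G g =
  (Odd g × HasCycleOfLength G g) ×
  (∀ k → Odd k → HasCycleOfLength G k → g ≤ k)

allSubsets : (n : ℕ) → List (Subset n)
allSubsets zero = [] ∷ []
allSubsets (suc n) = map (inside ∷_) (allSubsets n) ++ map (outside ∷_) (allSubsets n)

Independent : ∀ {n} → Graph n → Subset n → Set
Independent G I = ∀ u v → u ∈ I → v ∈ I → adj G u v ≡ false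

sumℚ : List ℚ → ℚ
sumℚ = foldr _+_ 0ℚ

-- LP variables y_I, one per subset; non-independent subsets are forced to 0,
-- so this is exactly the LP indexed by the independent sets.
Feasible : ∀ {n} → Graph n → (Subset n → ℚ) → Set
Feasible {n} G y =
  (∀ I → ¬ Independent G I → y I ≡ 0ℚ) ×
  (∀ I → 0ℚ ≤ℚ y I) ×
  (∀ v → Data.Rational.1ℚ ≤ℚ sumℚ (map (λ I → if does (v ∈? I) then y I else 0ℚ) (allSubsets n)))
  where open import Data.Bool using (if_then_else_)
        import Data.Rational

objective : ∀ {n} → (Subset n → ℚ) → ℚ
objective {n} y = sumℚ (map y (allSubsets n))

IsFracChromaticNumber : ∀ {n} → Graph n → ℚ → Set
IsFracChromaticNumber G q =
  (Σ _ λ y → Feasible G y × objective y ≡ q) ×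
  (∀ y → Feasible G y → q ≤ℚ objective y)

-- Write k = ρ − 1, so that the odd girth is 2k + 1.
--
-- Lower bound: summing the covering constraints over the 2k + 1 vertices of a shortest odd cycle
-- gives 2k + 1, while an independent set meets that cycle in at most k vertices, so
-- k · Σ_I y_I ≥ 2k + 1.
--
-- Upper bound: G maps homomorphically onto the cycle C_{2k+1}. Send v_p to vertex 0, and a vertex
-- x of the bipartite graph G ∖ v_p to 1 + its distance in G ∖ v_p from the neighbours of v_p of
-- colour false, capped at 2k − 1 or 2k according to the colour of x. The odd girth forces the
-- neighbours of v_p of colour true onto 2k, next to 0. Pulling back the 2k + 1 independent k-sets
-- of C_{2k+1} with weight 1/k gives a feasible solution of value (2k + 1)/k.

module Submission where

module RationalMultiples where

  open import Data.Nat as ℕ using (ℕ; zero; suc; s≤s; z≤n)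
  import Data.Nat.Properties as ℕP
  open import Data.Nat.Coprimality using (1-coprimeTo)
  import Data.Nat.Coprimality as Coprime
  open import Data.Integer using (+_)
  import Data.Integer.Properties as ℤP
  open import Data.Rational as ℚ using (ℚ; 0ℚ; 1ℚ; _+_; _*_; _/_; _≤_; mkℚ; 1/_)
  import Data.Rational.Properties as ℚP
  open import Algebra.Bundles using (Ring)
  open import Algebra.Properties.Semiring.Mult (Ring.semiring ℚP.+-*-ring)
    using (×-assoc-*; ×-comm-*; ×-homo-+)
  open import Algebra.Properties.Semiring.Mult (Ring.semiring ℚP.+-*-ring) public
    using () renaming (_×_ to _·_)
  open import Relation.Binary.PropositionalEquality

  private
    fromℕ : ℕ → ℚ
    fromℕ n = mkℚ (+ n) 0 (Coprime.sym (1-coprimeTo n))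

    ·1ℚ : ∀ n → n · 1ℚ ≡ fromℕ n
    ·1ℚ zero    = refl
    ·1ℚ (suc n) rewrite ·1ℚ n | ℕP.*-identityʳ n | ℤP.+◃n≡+n n = ℚP.normalize-coprime _

  ·-inverse : ∀ k .{{_ : ℕ.NonZero k}} → k · (+ 1 / k) ≡ 1ℚ
  ·-inverse (suc j) = begin
    suc j · w                        ≡⟨ cong (suc j ·_) (ℚP.*-identityˡ w) ⟨
    suc j · (1ℚ * w)                 ≡⟨ ×-assoc-* (suc j) 1ℚ w ⟨
    (suc j · 1ℚ) * w                 ≡⟨ cong₂ _*_ (·1ℚ (suc j)) (ℚP.normalize-coprime (1-coprimeTo (suc j))) ⟩
    fromℕ (suc j) * 1/ fromℕ (suc j) ≡⟨ ℚP.*-inverseʳ (fromℕ (suc j)) ⟩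
    1ℚ                               ∎
    where
    open ≡-Reasoning
    w = + 1 / suc j

  1/n-nonNeg : ∀ n .{{_ : ℕ.NonZero n}} → 0ℚ ≤ + 1 / n
  1/n-nonNeg n = ℚP.nonNegative⁻¹ (+ 1 / n) {{ℚP.normalize-nonNeg 1 n}}

  ·-zeroʳ : ∀ n → n · 0ℚ ≡ 0ℚ
  ·-zeroʳ zero    = refl
  ·-zeroʳ (suc n) = trans (ℚP.+-identityˡ _) (·-zeroʳ n)

  ·-monoˡ-≤ : ∀ {m n x} → 0ℚ ≤ x → m ℕ.≤ n → m · x ≤ n · x
  ·-monoˡ-≤ {n = n} {x} x≥0 z≤n = ·-nonNeg n
    where
    ·-nonNeg : ∀ n → 0ℚ ≤ n · x
    ·-nonNeg zero    = ℚP.≤-refl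
    ·-nonNeg (suc n) = ℚP.≤-trans (ℚP.≤-reflexive (sym (ℚP.+-identityˡ 0ℚ))) (ℚP.+-mono-≤ x≥0 (·-nonNeg n))
  ·-monoˡ-≤ {x = x} x≥0 (s≤s m≤n) = ℚP.+-monoʳ-≤ x (·-monoˡ-≤ x≥0 m≤n)

  ·-≤-divide : ∀ {k m w x} → 0ℚ ≤ w → k · w ≡ 1ℚ → m · 1ℚ ≤ k · x → m · w ≤ x
  ·-≤-divide {k} {m} {w} {x} w≥0 k·w≡1 m≤k·x = begin
    m · w          ≡⟨ cong (m ·_) (ℚP.*-identityʳ w) ⟨
    m · (w * 1ℚ)   ≡⟨ ×-comm-* m w 1ℚ ⟨
    w * (m · 1ℚ)   ≤⟨ ℚP.*-monoˡ-≤-nonNeg w {{ℚ.nonNegative w≥0}} m≤k·x ⟩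
    w * (k · x)    ≡⟨ ×-comm-* k w x ⟩
    k · (w * x)    ≡⟨ ×-assoc-* k w x ⟨
    (k · w) * x    ≡⟨ cong (_* x) k·w≡1 ⟩
    1ℚ * x         ≡⟨ ℚP.*-identityˡ x ⟩
    x              ∎
    where open ℚP.≤-Reasoning

  oddCycle-value : ∀ k .{{_ : ℕ.NonZero k}} → suc (k ℕ.+ k) · (+ 1 / k) ≡ (+ 2 / 1) + (+ 1 / k)
  oddCycle-value k = begin
    w + (k ℕ.+ k) · w     ≡⟨ cong (_+_ w) (×-homo-+ w k k) ⟩
    w + (k · w + k · w)   ≡⟨ cong (λ x → w + (x + x)) (·-inverse k) ⟩
    w + (1ℚ + 1ℚ)         ≡⟨ ℚP.+-comm w (1ℚ + 1ℚ) ⟩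
    (+ 2 / 1) + w         ∎
    where
    open ≡-Reasoning
    w = + 1 / k

module FiniteSums where

  open import Function using (_∘_)
  open import Data.Bool using (Bool; true; false; if_then_else_)
  open import Data.Nat as ℕ using (ℕ; zero; suc; s≤s; z≤n)
  import Data.Nat.Properties as ℕP
  open import Data.Nat.Tactic.RingSolver using (solve-∀)
  open import Data.Fin using (Fin; zero; suc; inject₁; fromℕ)
  open import Data.Rational as ℚ using (ℚ; 0ℚ; _+_; _≤_)
  import Data.Rational.Properties as ℚP
  open import Data.List using (List; []; _∷_; map; _++_; length; tabulate; upTo; _∷ʳ_)
  import Data.List.Properties as ListP
  open import Data.Empty using (⊥-elim)
  open import Relation.Nullary using (Dec; yes; no; ¬_; does)
  open import Algebra.Bundles using (CommutativeMonoid)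
  open import Algebra.Properties.CommutativeMonoid.Mult ℚP.+-0-commutativeMonoid using (×-distrib-+)
  open import Algebra.Properties.CommutativeMonoid.Sum ℕP.+-0-commutativeMonoid
    using (sum; sum-init-last; ∑-distrib-+)
  open import Algebra.Properties.CommutativeSemigroup
    (CommutativeMonoid.commutativeSemigroup ℚP.+-0-commutativeMonoid)
    using () renaming (interchange to +-interchange)
  open import Relation.Binary.PropositionalEquality
  open import Defs using (sumℚ)
  open RationalMultiples using (_·_; ·-zeroʳ)

  private
    variable
      A B : Set

  indicator : ∀ {P : Set} → Dec P → ℚ → ℚ
  indicator P? w = if does P? then w else 0ℚ

  indicator-nonNeg : ∀ {P : Set} (P? : Dec P) {w} → 0ℚ ≤ w → 0ℚ ≤ indicator P? w
  indicator-nonNeg (yes _) w≥0 = w≥0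
  indicator-nonNeg (no _)  w≥0 = ℚP.≤-refl

  indicator-complement : ∀ {P Q : Set} (P? : Dec P) (Q? : Dec Q) w →
    (P → ¬ Q) → (¬ P → Q) → indicator P? w + indicator Q? w ≡ w
  indicator-complement (yes p) (yes q) w P⇒¬Q ¬P⇒Q = ⊥-elim (P⇒¬Q p q)
  indicator-complement (yes p) (no ¬q) w P⇒¬Q ¬P⇒Q = ℚP.+-identityʳ w
  indicator-complement (no ¬p) (yes q) w P⇒¬Q ¬P⇒Q = ℚP.+-identityˡ w
  indicator-complement (no ¬p) (no ¬q) w P⇒¬Q ¬P⇒Q = ⊥-elim (¬q (¬P⇒Q ¬p))

  sumℚ-++ : ∀ xs ys → sumℚ (xs ++ ys) ≡ sumℚ xs + sumℚ ys
  sumℚ-++ []       ys = sym (ℚP.+-identityˡ _)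
  sumℚ-++ (x ∷ xs) ys = trans (cong (x +_) (sumℚ-++ xs ys)) (sym (ℚP.+-assoc x _ _))

  sumℚ-map-cong : ∀ (xs : List A) {f g : A → ℚ} → (∀ a → f a ≡ g a) → sumℚ (map f xs) ≡ sumℚ (map g xs)
  sumℚ-map-cong []       f≗g = refl
  sumℚ-map-cong (a ∷ xs) f≗g = cong₂ _+_ (f≗g a) (sumℚ-map-cong xs f≗g)

  sumℚ-map-mono : ∀ (xs : List A) {f g : A → ℚ} → (∀ a → f a ≤ g a) → sumℚ (map f xs) ≤ sumℚ (map g xs)
  sumℚ-map-mono []       f≤g = ℚP.≤-refl
  sumℚ-map-mono (a ∷ xs) f≤g = ℚP.+-mono-≤ (f≤g a) (sumℚ-map-mono xs f≤g)

  sumℚ-map-const : ∀ (xs : List A) x → sumℚ (map (λ _ → x) xs) ≡ length xs · x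
  sumℚ-map-const []       x = refl
  sumℚ-map-const (a ∷ xs) x = cong (x +_) (sumℚ-map-const xs x)

  sumℚ-map-0 : ∀ (xs : List A) → sumℚ (map (λ _ → 0ℚ) xs) ≡ 0ℚ
  sumℚ-map-0 []       = refl
  sumℚ-map-0 (a ∷ xs) = trans (ℚP.+-identityˡ _) (sumℚ-map-0 xs)

  sumℚ-map-+ : ∀ (xs : List A) f g → sumℚ (map (λ a → f a + g a) xs) ≡ sumℚ (map f xs) + sumℚ (map g xs)
  sumℚ-map-+ []       f g = refl
  sumℚ-map-+ (a ∷ xs) f g = trans (cong (f a + g a +_) (sumℚ-map-+ xs f g)) (+-interchange (f a) (g a) _ _)

  sumℚ-map-· : ∀ (xs : List A) n f → sumℚ (map (λ a → n · f a) xs) ≡ n · sumℚ (map f xs)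
  sumℚ-map-· []       n f = sym (·-zeroʳ n)
  sumℚ-map-· (a ∷ xs) n f = trans (cong (n · f a +_) (sumℚ-map-· xs n f)) (sym (×-distrib-+ (f a) _ n))

  if-sumℚ-map : ∀ b (xs : List A) f → (if b then sumℚ (map f xs) else 0ℚ) ≡ sumℚ (map (λ a → if b then f a else 0ℚ) xs)
  if-sumℚ-map true  xs f = refl
  if-sumℚ-map false xs f = sym (sumℚ-map-0 xs)

  sumℚ-map-comm : ∀ (xs : List A) (ys : List B) (F : A → B → ℚ) →
    sumℚ (map (λ a → sumℚ (map (F a) ys)) xs) ≡ sumℚ (map (λ b → sumℚ (map (λ a → F a b) xs)) ys)
  sumℚ-map-comm []       ys F = sym (sumℚ-map-0 ys)
  sumℚ-map-comm (a ∷ xs) ys F =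
    trans (cong (sumℚ (map (F a) ys) +_) (sumℚ-map-comm xs ys F))
          (sym (sumℚ-map-+ ys (F a) (λ b → sumℚ (map (λ a → F a b) xs))))

  sumℚ-complement : ∀ (xs : List A) {P Q : A → Set} (P? : ∀ a → Dec (P a)) (Q? : ∀ a → Dec (Q a)) w →
    (∀ {a} → P a → ¬ Q a) → (∀ {a} → ¬ P a → Q a) →
    sumℚ (map (λ a → indicator (P? a) w) xs) + sumℚ (map (λ a → indicator (Q? a) w) xs) ≡ length xs · w
  sumℚ-complement xs P? Q? w P⇒¬Q ¬P⇒Q = begin
    sumℚ (map (λ a → indicator (P? a) w) xs) + sumℚ (map (λ a → indicator (Q? a) w) xs)
      ≡⟨ sumℚ-map-+ xs _ _ ⟨
    sumℚ (map (λ a → indicator (P? a) w + indicator (Q? a) w) xs)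
      ≡⟨ sumℚ-map-cong xs (λ a → indicator-complement (P? a) (Q? a) w P⇒¬Q ¬P⇒Q) ⟩
    sumℚ (map (λ _ → w) xs)
      ≡⟨ sumℚ-map-const xs w ⟩
    length xs · w ∎
    where open ≡-Reasoning

  sumℚ-map-tabulate-if : ∀ {m} (g : Fin m → A) (b : A → Bool) x →
    sumℚ (map (λ a → if b a then x else 0ℚ) (tabulate g)) ≡ sum (λ i → if b (g i) then 1 else 0) · x
  sumℚ-map-tabulate-if {m = zero}  g b x = refl
  sumℚ-map-tabulate-if {m = suc m} g b x with b (g zero)
  ... | true  = cong (x +_) (sumℚ-map-tabulate-if (g ∘ suc) b x)
  ... | false = trans (ℚP.+-identityˡ _) (sumℚ-map-tabulate-if (g ∘ suc) b x)

  sumℚ-map-upTo-suc : ∀ k (f : ℕ → ℚ) → sumℚ (map f (upTo (suc k))) ≡ f 0 + sumℚ (map (f ∘ suc) (upTo k))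
  sumℚ-map-upTo-suc k f =
    cong (λ xs → f 0 + sumℚ xs) (trans (ListP.map-applyUpTo suc f k) (sym (ListP.map-upTo (f ∘ suc) k)))

  sumℚ-map-upTo-≤-suc : ∀ k {f : ℕ → ℚ} → (∀ i → 0ℚ ≤ f i) → sumℚ (map f (upTo k)) ≤ sumℚ (map f (upTo (suc k)))
  sumℚ-map-upTo-≤-suc k {f} f≥0 = begin
    sumℚ (map f (upTo k))                    ≡⟨ ℚP.+-identityʳ _ ⟨
    sumℚ (map f (upTo k)) + 0ℚ               ≤⟨ ℚP.+-monoʳ-≤ (sumℚ (map f (upTo k))) (ℚP.≤-trans (f≥0 k) (ℚP.≤-reflexive (sym (ℚP.+-identityʳ (f k))))) ⟩
    sumℚ (map f (upTo k)) + sumℚ (f k ∷ [])  ≡⟨ sumℚ-++ (map f (upTo k)) (f k ∷ []) ⟨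
    sumℚ (map f (upTo k) ++ f k ∷ [])        ≡⟨ cong sumℚ (ListP.map-++ f (upTo k) (k ∷ [])) ⟨
    sumℚ (map f (upTo k ∷ʳ k))               ≡⟨ cong (sumℚ ∘ map f) (ListP.upTo-∷ʳ k) ⟩
    sumℚ (map f (upTo (suc k)))              ∎
    where open ℚP.≤-Reasoning

  ∑-mono-≤ : ∀ {m} {f g : Fin m → ℕ} → (∀ i → f i ℕ.≤ g i) → sum f ℕ.≤ sum g
  ∑-mono-≤ {zero}  f≤g = z≤n
  ∑-mono-≤ {suc m} f≤g = ℕP.+-mono-≤ (f≤g zero) (∑-mono-≤ (f≤g ∘ suc))

  ∑-1 : ∀ m → sum {m} (λ _ → 1) ≡ m
  ∑-1 zero    = refl
  ∑-1 (suc m) = cong suc (∑-1 m)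

  cyclic-∑-≤ : ∀ m (f : Fin (suc m) → ℕ) →
    (∀ (i : Fin m) → f (inject₁ i) ℕ.+ f (suc i) ℕ.≤ 1) → f (fromℕ m) ℕ.+ f zero ℕ.≤ 1 →
    sum f ℕ.+ sum f ℕ.≤ suc m
  cyclic-∑-≤ m f steps closing = begin
    sum f ℕ.+ sum f
      ≡⟨ cong (ℕ._+ sum f) (sum-init-last f) ⟩
    (sum (f ∘ inject₁) ℕ.+ f (fromℕ m)) ℕ.+ (f zero ℕ.+ sum (f ∘ suc))
      ≡⟨ +-rotate (sum (f ∘ inject₁)) (f (fromℕ m)) (f zero) (sum (f ∘ suc)) ⟩
    (sum (f ∘ inject₁) ℕ.+ sum (f ∘ suc)) ℕ.+ (f (fromℕ m) ℕ.+ f zero)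
      ≡⟨ cong (ℕ._+ (f (fromℕ m) ℕ.+ f zero)) (∑-distrib-+ (f ∘ inject₁) (f ∘ suc)) ⟨
    sum (λ i → f (inject₁ i) ℕ.+ f (suc i)) ℕ.+ (f (fromℕ m) ℕ.+ f zero)
      ≤⟨ ℕP.+-mono-≤ (∑-mono-≤ steps) closing ⟩
    sum {m} (λ _ → 1) ℕ.+ 1
      ≡⟨ cong (ℕ._+ 1) (∑-1 m) ⟩
    m ℕ.+ 1
      ≡⟨ ℕP.+-comm m 1 ⟩
    suc m ∎
    where
    open ℕP.≤-Reasoning
    +-rotate : ∀ a b c d → (a ℕ.+ b) ℕ.+ (c ℕ.+ d) ≡ (a ℕ.+ d) ℕ.+ (b ℕ.+ c)
    +-rotate = solve-∀

  half-≤ : ∀ b k → b ℕ.+ b ℕ.≤ suc (k ℕ.+ k) → b ℕ.≤ k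
  half-≤ zero    k       _ = z≤n
  half-≤ (suc b) zero    (s≤s b+b≤0) rewrite ℕP.+-suc b b with b+b≤0
  ... | ()
  half-≤ (suc b) (suc k) (s≤s b+b≤k+k) rewrite ℕP.+-suc b b | ℕP.+-suc k k = s≤s (half-≤ b k (ℕP.≤-pred b+b≤k+k))

module Graphs where

  open import Function using (_∘_)
  open import Data.Bool using (true)
  open import Data.Nat using (suc)
  open import Data.Fin using (Fin; punchIn; punchOut; _≟_)
  open import Data.Fin.Properties using (punchIn-punchOut)
  open import Data.Fin.Subset using (Subset; _∈_)
  open import Relation.Nullary using (yes; no)
  open import Relation.Binary.PropositionalEquality
  open import Defs using (Graph; adj; irrefl; Independent)

  adj-sym : ∀ {n} (G : Graph n) {x y} → adj G x y ≡ true → adj G y x ≡ true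
  adj-sym G {x} {y} e = trans (Graph.sym G y x) e

  adj-irreflexive : ∀ {n} (G : Graph n) {x} → adj G x x ≢ true
  adj-irreflexive G {x} e with trans (sym e) (irrefl G x)
  ... | ()

  independent⇒¬adj : ∀ {n} (G : Graph n) {I : Subset n} → Independent G I → ∀ {u v} → u ∈ I → v ∈ I → adj G u v ≢ true
  independent⇒¬adj G independent {u} {v} u∈I v∈I e with trans (sym e) (independent u v u∈I v∈I)
  ... | ()

  data Punched {n} (p : Fin (suc n)) : Fin (suc n) → Set where
    centre  : Punched p p
    punched : (x : Fin n) → Punched p (punchIn p x)

  punched? : ∀ {n} (p u : Fin (suc n)) → Punched p u
  punched? p u with u ≟ p
  ... | yes refl = centre
  ... | no u≢p   = subst (Punched p) (punchIn-punchOut (u≢p ∘ sym)) (punched (punchOut (u≢p ∘ sym)))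

module OddClosedWalks where

  open import Function using (_∘_)
  open import Data.Bool using (true)
  open import Data.Nat using (ℕ; zero; suc; s≤s; z≤n; _+_; _<_; _≤_)
  import Data.Nat.Properties as ℕP
  open import Data.Nat.Induction using (<-wellFounded)
  open import Data.Nat.Tactic.RingSolver using (solve-∀)
  open import Induction.WellFounded using (Acc; acc)
  open import Data.Fin using (Fin; zero; suc; inject₁; fromℕ)
  import Data.Fin.Properties as FinP
  open import Data.Product using (∃; ∃₂; _×_; _,_)
  open import Data.Sum using (_⊎_; inj₁; inj₂)
  import Data.Sum as Sum
  open import Data.Empty using (⊥-elim)
  open import Data.List using (List; []; _∷_)
  open import Data.List.Membership.Propositional using (_∈_)
  open import Data.List.Relation.Unary.Any using (here; there)
  import Data.List.Relation.Unary.All as All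
  open import Data.List.Relation.Unary.All.Properties using (¬Any⇒All¬)
  open import Data.List.Relation.Unary.Unique.Propositional using (Unique; []; _∷_)
  open import Function.Definitions using (Injective)
  open import Relation.Nullary using (yes; no)
  open import Relation.Binary.PropositionalEquality
  open import Defs using (Graph; adj; HasCycleOfLength; Odd; odd1; oddSS)
  open Graphs using (adj-irreflexive)

  Odd-+⁻ : ∀ a {b} → Odd (a + b) → Odd a ⊎ Odd b
  Odd-+⁻ zero          o         = inj₂ o
  Odd-+⁻ (suc zero)    _         = inj₁ odd1
  Odd-+⁻ (suc (suc a)) (oddSS o) = Sum.map₁ oddSS (Odd-+⁻ a o)

  Odd-1+2* : ∀ s → Odd (suc (s + s))
  Odd-1+2* zero    = odd1
  Odd-1+2* (suc s) rewrite ℕP.+-suc s s = oddSS (Odd-1+2* s)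

  infixr 5 _◅_

  data Walk {n} (G : Graph n) : Fin n → Fin n → ℕ → Set where
    []  : ∀ {x} → Walk G x x 0
    _◅_ : ∀ {x y z ℓ} → adj G x y ≡ true → Walk G y z ℓ → Walk G x z (suc ℓ)

  module _ {n} {G : Graph n} where

    open import Data.List.Membership.DecPropositional (FinP._≟_ {n}) using (_∈?_)

    private
      variable
        x y z v : Fin n
        ℓ m ℓ₁ ℓ₂ : ℕ

    infixr 5 _++ᵂ_
    _++ᵂ_ : Walk G x y ℓ₁ → Walk G y z ℓ₂ → Walk G x z (ℓ₁ + ℓ₂)
    []      ++ᵂ w′ = w′
    (e ◅ w) ++ᵂ w′ = e ◅ (w ++ᵂ w′)

    vertices : Walk G x y ℓ → List (Fin n)
    vertices []            = []
    vertices (_◅_ {x} _ w) = x ∷ vertices w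

    vertexAt : Walk G x y ℓ → Fin (suc ℓ) → Fin n
    vertexAt {x = x} _ zero    = x
    vertexAt (_ ◅ w) (suc i) = vertexAt w i

    vertexAt-last : (w : Walk G x y ℓ) → vertexAt w (fromℕ ℓ) ≡ y
    vertexAt-last []      = refl
    vertexAt-last (_ ◅ w) = vertexAt-last w

    vertexAt-adj : (w : Walk G x y ℓ) (i : Fin ℓ) → adj G (vertexAt w (inject₁ i)) (vertexAt w (suc i)) ≡ true
    vertexAt-adj (e ◅ w) zero    = e
    vertexAt-adj (e ◅ w) (suc i) = vertexAt-adj w i

    vertexAt-∈ : (w : Walk G x y ℓ) (i : Fin ℓ) → vertexAt w (inject₁ i) ∈ vertices w
    vertexAt-∈ (e ◅ w) zero    = here refl
    vertexAt-∈ (e ◅ w) (suc i) = there (vertexAt-∈ w i)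

    vertexAt-injective : (w : Walk G x y ℓ) → Unique (vertices w) → Injective _≡_ _≡_ (vertexAt w ∘ inject₁)
    vertexAt-injective (e ◅ w) (x∉w ∷ u) {zero}  {zero}  _  = refl
    vertexAt-injective (e ◅ w) (x∉w ∷ u) {zero}  {suc j} eq = ⊥-elim (All.lookup x∉w (vertexAt-∈ w j) eq)
    vertexAt-injective (e ◅ w) (x∉w ∷ u) {suc i} {zero}  eq = ⊥-elim (All.lookup x∉w (vertexAt-∈ w i) (sym eq))
    vertexAt-injective (e ◅ w) (x∉w ∷ u) {suc i} {suc j} eq = cong suc (vertexAt-injective w u eq)

    closedWalk⇒cycle : (w : Walk G x x (suc m)) → Unique (vertices w) → 2 ≤ m → HasCycleOfLength G (suc m)
    closedWalk⇒cycle {m = m} w u 2≤m =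
      vertexAt w ∘ inject₁ , s≤s 2≤m , vertexAt-injective w u , vertexAt-adj w ∘ inject₁ , closing
      where
      closing : adj G (vertexAt w (inject₁ (fromℕ m))) (vertexAt w zero) ≡ true
      closing = subst (λ v → adj G (vertexAt w (inject₁ (fromℕ m))) v ≡ true) (vertexAt-last w) (vertexAt-adj w (fromℕ m))

    split : (w : Walk G x y ℓ) → v ∈ vertices w →
            ∃₂ λ ℓ₁ ℓ₂ → Walk G x v ℓ₁ × Walk G v y (suc ℓ₂) × ℓ₁ + suc ℓ₂ ≡ ℓ
    split (e ◅ w) (here refl) = 0 , _ , [] , e ◅ w , refl
    split (e ◅ w) (there v∈w) with split w v∈w
    ... | ℓ₁ , ℓ₂ , before , after , eq = suc ℓ₁ , ℓ₂ , e ◅ before , after , cong suc eq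

    record Detour (x y : Fin n) (ℓ : ℕ) : Set where
      constructor detour
      field
        {a}        : Fin n
        {l₁ l₂ l₃} : ℕ
        before     : Walk G x a l₁
        loop       : Walk G a a (suc l₂)
        after      : Walk G a y (suc l₃)
        length≡    : l₁ + suc l₂ + suc l₃ ≡ ℓ

    unique⊎detour : (w : Walk G x y ℓ) → Unique (vertices w) ⊎ Detour x y ℓ
    unique⊎detour []                = inj₁ []
    unique⊎detour (_◅_ {x} e w) with x ∈? vertices w
    ... | yes x∈w with split w x∈w
    ...   | _ , _ , before , after , eq = inj₂ (detour [] (e ◅ before) after (cong suc eq))
    unique⊎detour (_◅_ {x} e w) | no x∉w with unique⊎detour w
    ... | inj₁ u                             = inj₁ (¬Any⇒All¬ _ x∉w ∷ u)
    ... | inj₂ (detour before loop after eq) = inj₂ (detour (e ◅ before) loop after (cong suc eq))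

    uniqueOddClosedWalk⇒cycle : (w : Walk G x x ℓ) → Unique (vertices w) → Odd ℓ → HasCycleOfLength G ℓ
    uniqueOddClosedWalk⇒cycle (e ◅ []) _ odd1      = ⊥-elim (adj-irreflexive G e)
    uniqueOddClosedWalk⇒cycle w        u (oddSS o) = closedWalk⇒cycle w u (s≤s (Odd⇒≥1 o))
      where
      Odd⇒≥1 : ∀ {k} → Odd k → 1 ≤ k
      Odd⇒≥1 odd1      = s≤s z≤n
      Odd⇒≥1 (oddSS _) = s≤s z≤n

    -- Cutting out the loop leaves a closed walk too, and one of the two is odd.
    detour⇒shorterOddClosedWalk : Detour x x ℓ → Odd ℓ → ∃₂ λ v ℓ′ → ℓ′ < ℓ × Walk G v v ℓ′ × Odd ℓ′
    detour⇒shorterOddClosedWalk (detour {l₁ = l₁} {l₂} {l₃} before loop after eq) o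
      with trans (regroup l₁ l₂ l₃) eq
      where
      regroup : ∀ l₁ l₂ l₃ → suc l₂ + suc (l₃ + l₁) ≡ l₁ + suc l₂ + suc l₃
      regroup = solve-∀
    ... | total with Odd-+⁻ (suc l₂) (subst Odd (sym total) o)
    ...   | inj₁ odd-loop =
      _ , _ , subst (suc l₂ <_) total (ℕP.m<m+n (suc l₂) (s≤s z≤n)) , loop , odd-loop
    ...   | inj₂ odd-rest =
      _ , _ , subst (suc (l₃ + l₁) <_) total (ℕP.m<n+m (suc (l₃ + l₁)) (s≤s z≤n)) , after ++ᵂ before , odd-rest

    oddClosedWalk⇒oddCycle : Walk G x x ℓ → Odd ℓ → ∃ λ m → m ≤ ℓ × Odd m × HasCycleOfLength G m
    oddClosedWalk⇒oddCycle = go (<-wellFounded _)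
      where
      go : Acc _<_ ℓ → Walk G x x ℓ → Odd ℓ → ∃ λ m → m ≤ ℓ × Odd m × HasCycleOfLength G m
      go (acc rec) w o with unique⊎detour w
      ... | inj₁ u = _ , ℕP.≤-refl , o , uniqueOddClosedWalk⇒cycle w u o
      ... | inj₂ d with detour⇒shorterOddClosedWalk d o
      ...   | _ , _ , ℓ′<ℓ , w′ , o′ with go (rec ℓ′<ℓ) w′ o′
      ...     | m , m≤ℓ′ , om , c = m , ℕP.≤-trans m≤ℓ′ (ℕP.<⇒≤ ℓ′<ℓ) , om , c

    oddClosedWalk-≥ : ∀ {g} → (∀ m → Odd m → HasCycleOfLength G m → g ≤ m) → Walk G x x ℓ → Odd ℓ → g ≤ ℓ
    oddClosedWalk-≥ shortest w o with oddClosedWalk⇒oddCycle w o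
    ... | m , m≤ℓ , om , c = ℕP.≤-trans (shortest m om c) m≤ℓ

module BoundedSearch where

  open import Function using (_∘_)
  open import Level using (0ℓ)
  open import Data.Nat using (ℕ; zero; suc; s≤s; z≤n; _<_; _≤_)
  import Data.Nat.Properties as ℕP
  open import Data.Sum using (inj₁; inj₂)
  open import Data.Empty using (⊥-elim)
  open import Relation.Nullary using (yes; no)
  open import Relation.Unary using (Pred; Decidable)
  open import Relation.Binary.PropositionalEquality

  -- The least d < b satisfying P, or b if there is none.
  least : {P : Pred ℕ 0ℓ} → Decidable P → ℕ → ℕ
  least P? zero    = zero
  least P? (suc b) with P? zero
  ... | yes _ = zero
  ... | no  _ = suc (least (P? ∘ suc) b)

  private
    variable
      P Q : Pred ℕ 0ℓ

  least-≤-bound : ∀ (P? : Decidable P) b → least P? b ≤ b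
  least-≤-bound P? zero    = z≤n
  least-≤-bound P? (suc b) with P? zero
  ... | yes _ = z≤n
  ... | no  _ = s≤s (least-≤-bound (P? ∘ suc) b)

  least-≤ : ∀ (P? : Decidable P) b {d} → P d → least P? b ≤ d
  least-≤ P? zero    _  = z≤n
  least-≤ P? (suc b) {d} pd with P? zero
  least-≤ P? (suc b) {d}     pd | yes _  = z≤n
  least-≤ P? (suc b) {zero}  pd | no ¬p0 = ⊥-elim (¬p0 pd)
  least-≤ P? (suc b) {suc d} pd | no _   = s≤s (least-≤ (P? ∘ suc) b pd)

  least<⇒P : ∀ (P? : Decidable P) b → least P? b < b → P (least P? b)
  least<⇒P P? (suc b) lt with P? zero
  ... | yes p0 = p0
  ... | no  _  = least<⇒P (P? ∘ suc) b (ℕP.≤-pred lt)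

  least-≤-image : ∀ (P? : Decidable P) (Q? : Decidable Q) {f : ℕ → ℕ} b →
    (∀ {d} → P d → Q (f d)) → b ≤ f b → least Q? b ≤ f (least P? b)
  least-≤-image P? Q? {f} b P⇒Q b≤fb with ℕP.m≤n⇒m<n∨m≡n (least-≤-bound P? b)
  ... | inj₁ lt = least-≤ Q? b (P⇒Q (least<⇒P P? b lt))
  ... | inj₂ eq = ℕP.≤-trans (least-≤-bound Q? b) (subst (λ d → b ≤ f d) (sym eq) b≤fb)

  least-≡-bound : ∀ (P? : Decidable P) b → (∀ {d} → P d → b ≤ d) → least P? b ≡ b
  least-≡-bound P? b P⇒b≤ with ℕP.m≤n⇒m<n∨m≡n (least-≤-bound P? b)
  ... | inj₁ lt = ⊥-elim (ℕP.<⇒≱ lt (P⇒b≤ (least<⇒P P? b lt)))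
  ... | inj₂ eq = eq

module OddCycle where

  open import Function using (_∘_)
  open import Data.Nat using (ℕ; suc; s≤s; _<_; _≤_; _<?_; _≤?_)
  import Data.Nat.Properties as ℕP
  open import Data.Rational as ℚ using (0ℚ; _+_)
  import Data.Rational.Properties as ℚP
  open import Data.List using (map; length; upTo)
  import Data.List.Properties as ListP
  open import Data.Sum using (_⊎_; inj₁; inj₂)
  open import Data.Empty using (⊥)
  open import Relation.Nullary using (Dec)
  open import Relation.Binary.PropositionalEquality
  open import Defs using (sumℚ)
  open RationalMultiples using (_·_)
  open FiniteSums

  -- The cycle C_{2k+1} on 0, …, 2k: even t stands for the vertex 2t and odd t for 2t + 1.
  data Position : Set where
    even odd : ℕ → Position

  data Edge (k : ℕ) : Position → Position → Set where
    even-odd : ∀ t → Edge k (even t) (odd t)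
    odd-even : ∀ t → Edge k (odd t) (even (suc t))
    wrap     : Edge k (even k) (even 0)

  Adjacent : ℕ → Position → Position → Set
  Adjacent k p q = Edge k p q ⊎ Edge k q p

  -- The 2k + 1 independent k-sets of C_{2k+1}: E i = {odd vertices < 2i} ∪ {even vertices > 2i}
  -- for i ≤ k, and O i = {even vertices ≤ 2i} ∪ {odd vertices > 2i + 1} for i < k.
  _∈E_ : Position → ℕ → Set
  even t ∈E i = i < t
  odd  t ∈E i = t < i

  _∈O_ : Position → ℕ → Set
  even t ∈O i = t ≤ i
  odd  t ∈O i = i < t

  _∈E?_ : ∀ p i → Dec (p ∈E i)
  even t ∈E? i = i <? t
  odd  t ∈E? i = t <? i

  _∈O?_ : ∀ p i → Dec (p ∈O i)
  even t ∈O? i = t ≤? i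
  odd  t ∈O? i = i <? t

  E-independent : ∀ {k p q i} → Adjacent k p q → p ∈E i → q ∈E i → ⊥
  E-independent (inj₁ e) p∈ q∈ = edge e p∈ q∈
    where
    edge : ∀ {k p q i} → Edge k p q → p ∈E i → q ∈E i → ⊥
    edge (even-odd t) i<t t<i = ℕP.<-asym i<t t<i
    edge (odd-even t) t<i i≤t = ℕP.<⇒≱ t<i (ℕP.≤-pred i≤t)
    edge wrap         _   ()
  E-independent (inj₂ e) p∈ q∈ = E-independent (inj₁ e) q∈ p∈

  O-independent : ∀ {k p q i} → i < k → Adjacent k p q → p ∈O i → q ∈O i → ⊥
  O-independent i<k (inj₁ e) p∈ q∈ = edge i<k e p∈ q∈
    where
    edge : ∀ {k p q i} → i < k → Edge k p q → p ∈O i → q ∈O i → ⊥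
    edge _   (even-odd t) t≤i i<t = ℕP.<⇒≱ i<t t≤i
    edge _   (odd-even t) i<t t<i = ℕP.<-asym i<t t<i
    edge i<k wrap         k≤i _   = ℕP.<⇒≱ i<k k≤i
  O-independent i<k (inj₂ e) p∈ q∈ = O-independent i<k (inj₁ e) q∈ p∈

  -- Every vertex lies in k of the sets: for each i < k exactly one of two complementary conditions holds.
  arc-coverage : ∀ k {w} → 0ℚ ℚ.≤ w → ∀ p →
    k · w ℚ.≤ sumℚ (map (λ i → indicator (p ∈E? i) w) (upTo (suc k)))
          + sumℚ (map (λ i → indicator (p ∈O? i) w) (upTo k))
  arc-coverage k {w} w≥0 (even t) = begin
    k · w
      ≡⟨ cong (_· w) (ListP.length-upTo k) ⟨
    length (upTo k) · w
      ≡⟨ sumℚ-complement (upTo k) (_<? t) (t ≤?_) w ℕP.<⇒≱ ℕP.≮⇒≥ ⟨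
    sumℚ (map (λ i → indicator (i <? t) w) (upTo k)) + ΣO
      ≤⟨ ℚP.+-monoˡ-≤ ΣO (sumℚ-map-upTo-≤-suc k (λ i → indicator-nonNeg (i <? t) w≥0)) ⟩
    sumℚ (map (λ i → indicator (i <? t) w) (upTo (suc k))) + ΣO ∎
    where
    open ℚP.≤-Reasoning
    ΣO = sumℚ (map (λ i → indicator (t ≤? i) w) (upTo k))
  arc-coverage k {w} w≥0 (odd t) = ℚP.≤-reflexive (begin
    k · w
      ≡⟨ cong (_· w) (ListP.length-upTo k) ⟨
    length (upTo k) · w
      ≡⟨ sumℚ-complement (upTo k) (λ i → t <? suc i) (_<? t) w
           (λ t<1+i → ℕP.<⇒≱ (s≤s (ℕP.≤-pred t<1+i))) (ℕP.≤-pred ∘ ℕP.≰⇒>) ⟨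
    sumℚ (map (λ i → indicator (t <? suc i) w) (upTo k)) + ΣO
      ≡⟨ cong (_+ ΣO) (ℚP.+-identityˡ (sumℚ (map (λ i → indicator (t <? suc i) w) (upTo k)))) ⟨
    0ℚ + sumℚ (map (λ i → indicator (t <? suc i) w) (upTo k)) + ΣO
      ≡⟨ cong (_+ ΣO) (sumℚ-map-upTo-suc k (λ i → indicator (t <? i) w)) ⟨
    sumℚ (map (λ i → indicator (t <? i) w) (upTo (suc k))) + ΣO ∎)
    where
    open ≡-Reasoning
    ΣO = sumℚ (map (λ i → indicator (i <? t) w) (upTo k))


module HomomorphismToOddCycle where

  open import Function using (id)
  open import Data.Bool as Bool using (Bool; true; false)
  open import Data.Nat using (ℕ; zero; suc; _+_; _≤_)
  import Data.Nat.Properties as ℕP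
  open import Data.Fin using (Fin; punchIn)
  import Data.Fin.Properties as FinP
  open import Data.Product using (_×_; _,_; uncurry)
  open import Data.Sum using (inj₁; inj₂; swap)
  open import Data.Empty using (⊥-elim)
  open import Relation.Nullary using (Dec)
  open import Relation.Nullary.Decidable using (map′; _×-dec_)
  open import Relation.Binary.PropositionalEquality
  open import Defs using (Graph; adj; deleteVertex; Odd; oddSS)
  open FiniteSums using (half-≤)
  open Graphs using (adj-sym; adj-irreflexive; Punched; centre; punched; punched?)
  open OddClosedWalks using (Walk; _◅_; []; Odd-1+2*)
  open BoundedSearch
  open OddCycle using (Position; even; odd; Adjacent; even-odd; odd-even; wrap)

  -- Here k = suc j, and 2k + 1 is the odd girth of G.
  module Homomorphism {n} (G : Graph (suc n)) (vp : Fin (suc n))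
    (col : Fin n → Bool) (col-proper : ∀ x y → adj (deleteVertex G vp) x y ≡ true → col x ≢ col y)
    (j : ℕ) (odd-walk-bound : ∀ {x ℓ} → Walk G x x ℓ → Odd ℓ → suc (suc j + suc j) ≤ ℓ) where

    private
      H = deleteVertex G vp
      k = suc j

    data Reach : ℕ → Fin n → Set where
      start : ∀ {x} → adj G vp (punchIn vp x) ≡ true → col x ≡ false → Reach 0 x
      step  : ∀ {d x y} → adj H x y ≡ true → Reach d y → Reach (suc d) x

    reach? : ∀ d x → Dec (Reach d x)
    reach? zero    x = map′ (uncurry start) (λ { (start e c) → e , c })
                            ((adj G vp (punchIn vp x) Bool.≟ true) ×-dec (col x Bool.≟ false))
    reach? (suc d) x = map′ (λ (_ , e , r) → step e r) (λ { (step e r) → _ , e , r })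
                            (FinP.any? (λ y → (adj H x y Bool.≟ true) ×-dec reach? d y))

    reach⇒walk : ∀ {d x} → Reach d x → Walk G (punchIn vp x) vp (suc d)
    reach⇒walk (start e _) = adj-sym G e ◅ []
    reach⇒walk (step e r)  = e ◅ reach⇒walk r

    -- Walks from the start set to x have the parity of the colour of x. A vertex at distance 2s
    -- (colour false) or 2s + 1 (colour true) is placed at 2s + 1 resp. 2s + 2 on the cycle, with s
    -- capped at j.
    reachLength : Bool → ℕ → ℕ
    reachLength false s = s + s
    reachLength true  s = suc (s + s)

    halfDistance : Bool → Fin n → ℕ
    halfDistance c x = least (λ s → reach? (reachLength c s) x) j

    place : Bool → ℕ → Position
    place false s = odd s
    place true  s = even (suc s)

    positionOf : Bool → Fin n → Position
    positionOf c x = place c (halfDistance c x)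

    halfDistance-edge : ∀ {x y} → adj H x y ≡ true →
      halfDistance true y ≤ halfDistance false x × halfDistance false x ≤ suc (halfDistance true y)
    halfDistance-edge {x} {y} e =
      least-≤-image (λ s → reach? (s + s) x) (λ s → reach? (suc (s + s)) y) {f = id} j
        (step (adj-sym H e)) ℕP.≤-refl ,
      least-≤-image (λ s → reach? (suc (s + s)) y) (λ s → reach? (s + s) x) {f = suc} j
        (λ {s} r → subst (λ d → Reach d x) (cong suc (sym (ℕP.+-suc s s))) (step e r)) (ℕP.n≤1+n j)

    positionOf-adjacent-false-true : ∀ {x y} → adj H x y ≡ true → Adjacent k (positionOf false x) (positionOf true y)
    positionOf-adjacent-false-true {x} {y} e with halfDistance-edge e
    ... | sy≤sx , sx≤1+sy with ℕP.m≤n⇒m<n∨m≡n sx≤1+sy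
    ...   | inj₁ sx<1+sy = subst (λ s → Adjacent k (odd s) (positionOf true y))
                                 (ℕP.≤-antisym sy≤sx (ℕP.≤-pred sx<1+sy)) (inj₁ (odd-even _))
    ...   | inj₂ sx≡1+sy = subst (λ s → Adjacent k (odd s) (positionOf true y)) (sym sx≡1+sy) (inj₂ (even-odd _))

    positionOf-adjacent : ∀ {x y} → adj H x y ≡ true → Adjacent k (positionOf (col x) x) (positionOf (col y) y)
    positionOf-adjacent {x} {y} e with col x | col y | col-proper x y e
    ... | false | true  | _ = positionOf-adjacent-false-true e
    ... | true  | false | _ = swap (positionOf-adjacent-false-true (adj-sym H e))
    ... | false | false | ≢ = ⊥-elim (≢ refl)
    ... | true  | true  | ≢ = ⊥-elim (≢ refl)

    -- A neighbour of vp of colour true is at distance at least 2j + 1 from the start set, as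
    -- otherwise vp would lie on a closed odd walk shorter than 2k + 1.
    positionOf-adjacent-centre : ∀ {x} → adj G vp (punchIn vp x) ≡ true → Adjacent k (even 0) (positionOf (col x) x)
    positionOf-adjacent-centre {x} e with col x in c
    ... | false = subst (λ s → Adjacent k (even 0) (odd s)) (sym (ℕP.n≤0⇒n≡0 s≤0)) (inj₁ (even-odd 0))
      where
      s≤0 : halfDistance false x ≤ 0
      s≤0 = least-≤ (λ s → reach? (s + s) x) j (start e c)
    ... | true  = subst (λ s → Adjacent k (even 0) (even (suc s))) (sym s≡j) (inj₂ wrap)
      where
      far : ∀ {s} → Reach (suc (s + s)) x → j ≤ s
      far {s} r = half-≤ j s (ℕP.m≤n⇒m≤1+n (ℕP.≤-pred (ℕP.≤-pred 2j+2≤2s+2)))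
        where
        2j+2≤2s+2 : suc (suc (j + j)) ≤ suc (suc (s + s))
        2j+2≤2s+2 = subst (_≤ suc (suc (s + s))) (cong suc (ℕP.+-suc j j))
                      (ℕP.≤-pred (odd-walk-bound (e ◅ reach⇒walk r) (oddSS (Odd-1+2* s))))
      s≡j : halfDistance true x ≡ j
      s≡j = least-≡-bound (λ s → reach? (suc (s + s)) x) j far

    positionAt : ∀ {u} → Punched vp u → Position
    positionAt centre      = even 0
    positionAt (punched x) = positionOf (col x) x

    position : Fin (suc n) → Position
    position u = positionAt (punched? vp u)

    position-adjacent : ∀ {u v} → adj G u v ≡ true → Adjacent k (position u) (position v)
    position-adjacent {u} {v} = go (punched? vp u) (punched? vp v)
      where
      go : ∀ {u v} (pu : Punched vp u) (pv : Punched vp v) → adj G u v ≡ true → Adjacent k (positionAt pu) (positionAt pv)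
      go centre      centre      e = ⊥-elim (adj-irreflexive G e)
      go centre      (punched y) e = positionOf-adjacent-centre e
      go (punched x) centre      e = swap (positionOf-adjacent-centre (adj-sym G e))
      go (punched x) (punched y) e = positionOf-adjacent e

module FractionalColouring where

  open import Function using (_∘_)
  open import Level using (0ℓ)
  open import Data.Bool using (true; false; if_then_else_)
  import Data.Bool.Properties as BoolP
  open import Data.Nat as ℕ using (ℕ; zero; suc; z≤n; NonZero)
  import Data.Nat.Properties as ℕP
  open import Data.Fin using (Fin; zero; suc)
  open import Data.Fin.Subset using (Subset; inside; outside; _∈_)
  open import Data.Fin.Subset.Properties using (_∈?_)
  open import Data.Vec using ([]; _∷_; tabulate)
  import Data.Vec.Properties as VecP
  open import Data.Integer using (+_)
  open import Data.Rational using (ℚ; 0ℚ; 1ℚ; _+_; _/_; _≤_)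
  import Data.Rational.Properties as ℚP
  open import Data.List using (List; []; _∷_; map; _++_; length; upTo)
  import Data.List as List
  import Data.List.Properties as ListP
  open import Data.List.Relation.Unary.All using (All; []; _∷_; universal)
  open import Data.List.Relation.Unary.All.Properties using (++⁺; map⁺; applyUpTo⁺₁)
  open import Data.Product using (Σ; _×_; _,_)
  open import Data.Empty using (⊥; ⊥-elim)
  open import Relation.Nullary using (yes; no; ¬_; does)
  open import Relation.Nullary.Decidable using (dec-true)
  open import Relation.Unary using (Pred; Decidable)
  open import Relation.Binary using (DecidableEquality)
  open import Relation.Binary.PropositionalEquality
  open import Algebra.Properties.CommutativeMonoid.Sum ℕP.+-0-commutativeMonoid using (sum)
  open import Defs using (Graph; adj; allSubsets; Independent; IsCycle; Feasible; objective; sumℚ)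
  open RationalMultiples
  open FiniteSums
  open Graphs using (independent⇒¬adj)
  open OddCycle

  _≟ˢ_ : ∀ {n} → DecidableEquality (Subset n)
  _≟ˢ_ = VecP.≡-dec BoolP._≟_

  δ : ∀ {n} → Subset n → Subset n → ℚ → ℚ
  δ T I x = indicator (T ≟ˢ I) x

  sumℚ-allSubsets-suc : ∀ {n} (h : Subset (suc n) → ℚ) →
    sumℚ (map h (allSubsets (suc n))) ≡
    sumℚ (map (h ∘ (inside ∷_)) (allSubsets n)) + sumℚ (map (h ∘ (outside ∷_)) (allSubsets n))
  sumℚ-allSubsets-suc {n} h = begin
    sumℚ (map h (map (inside ∷_) L ++ map (outside ∷_) L))
      ≡⟨ cong sumℚ (ListP.map-++ h (map (inside ∷_) L) (map (outside ∷_) L)) ⟩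
    sumℚ (map h (map (inside ∷_) L) ++ map h (map (outside ∷_) L))
      ≡⟨ sumℚ-++ (map h (map (inside ∷_) L)) _ ⟩
    sumℚ (map h (map (inside ∷_) L)) + sumℚ (map h (map (outside ∷_) L))
      ≡⟨ cong₂ (λ xs ys → sumℚ xs + sumℚ ys) (ListP.map-∘ L) (ListP.map-∘ L) ⟨
    sumℚ (map (h ∘ (inside ∷_)) L) + sumℚ (map (h ∘ (outside ∷_)) L) ∎
    where
    open ≡-Reasoning
    L = allSubsets n

  sumℚ-allSubsets-δ : ∀ {n} (T : Subset n) (g : Subset n → ℚ) → sumℚ (map (λ I → δ T I (g I)) (allSubsets n)) ≡ g T
  sumℚ-allSubsets-δ []                  g = ℚP.+-identityʳ (g [])
  sumℚ-allSubsets-δ {suc n} (true  ∷ T) g = begin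
    _ ≡⟨ sumℚ-allSubsets-suc (λ I → δ (true ∷ T) I (g I)) ⟩
    sumℚ (map (λ I → δ T I (g (inside ∷ I))) (allSubsets n)) + sumℚ (map (λ _ → 0ℚ) (allSubsets n))
      ≡⟨ cong₂ _+_ (sumℚ-allSubsets-δ T (g ∘ (inside ∷_))) (sumℚ-map-0 (allSubsets n)) ⟩
    g (inside ∷ T) + 0ℚ ≡⟨ ℚP.+-identityʳ _ ⟩
    g (inside ∷ T) ∎
    where open ≡-Reasoning
  sumℚ-allSubsets-δ {suc n} (false ∷ T) g = begin
    _ ≡⟨ sumℚ-allSubsets-suc (λ I → δ (false ∷ T) I (g I)) ⟩
    sumℚ (map (λ _ → 0ℚ) (allSubsets n)) + sumℚ (map (λ I → δ T I (g (outside ∷ I))) (allSubsets n))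
      ≡⟨ cong₂ _+_ (sumℚ-map-0 (allSubsets n)) (sumℚ-allSubsets-δ T (g ∘ (outside ∷_))) ⟩
    0ℚ + g (outside ∷ T) ≡⟨ ℚP.+-identityˡ _ ⟩
    g (outside ∷ T) ∎
    where open ≡-Reasoning

  module _ {n} (G : Graph n) where

    private
      subsets = allSubsets n

    coverage : (Subset n → ℚ) → Fin n → ℚ
    coverage y v = sumℚ (map (λ I → indicator (v ∈? I) (y I)) subsets)

    uniform : List (Subset n) → ℚ → Subset n → ℚ
    uniform Ts w I = sumℚ (map (λ T → δ T I w) Ts)

    objective-uniform : ∀ Ts w → objective (uniform Ts w) ≡ length Ts · w
    objective-uniform Ts w = begin
      sumℚ (map (λ I → sumℚ (map (λ T → δ T I w) Ts)) subsets)
        ≡⟨ sumℚ-map-comm subsets Ts (λ I T → δ T I w) ⟩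
      sumℚ (map (λ T → sumℚ (map (λ I → δ T I w) subsets)) Ts)
        ≡⟨ sumℚ-map-cong Ts (λ T → sumℚ-allSubsets-δ T (λ _ → w)) ⟩
      sumℚ (map (λ _ → w) Ts)
        ≡⟨ sumℚ-map-const Ts w ⟩
      length Ts · w ∎
      where open ≡-Reasoning

    coverage-uniform : ∀ Ts w v → coverage (uniform Ts w) v ≡ sumℚ (map (λ T → indicator (v ∈? T) w) Ts)
    coverage-uniform Ts w v = begin
      sumℚ (map (λ I → indicator (v ∈? I) (sumℚ (map (λ T → δ T I w) Ts))) subsets)
        ≡⟨ sumℚ-map-cong subsets (λ I → if-sumℚ-map (does (v ∈? I)) Ts (λ T → δ T I w)) ⟩
      sumℚ (map (λ I → sumℚ (map (λ T → indicator (v ∈? I) (δ T I w)) Ts)) subsets)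
        ≡⟨ sumℚ-map-cong subsets (λ I → sumℚ-map-cong Ts (λ T → if-swap (does (v ∈? I)) (does (T ≟ˢ I)))) ⟩
      sumℚ (map (λ I → sumℚ (map (λ T → δ T I (g I)) Ts)) subsets)
        ≡⟨ sumℚ-map-comm subsets Ts (λ I T → δ T I (g I)) ⟩
      sumℚ (map (λ T → sumℚ (map (λ I → δ T I (g I)) subsets)) Ts)
        ≡⟨ sumℚ-map-cong Ts (λ T → sumℚ-allSubsets-δ T g) ⟩
      sumℚ (map g Ts) ∎
      where
      open ≡-Reasoning
      g : Subset n → ℚ
      g I = indicator (v ∈? I) w
      if-swap : ∀ b c → (if b then (if c then w else 0ℚ) else 0ℚ) ≡ (if c then (if b then w else 0ℚ) else 0ℚ)
      if-swap true  true  = refl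
      if-swap true  false = refl
      if-swap false true  = refl
      if-swap false false = refl

    uniform-feasible : ∀ {Ts w} → All (Independent G) Ts → 0ℚ ≤ w →
      (∀ v → 1ℚ ≤ sumℚ (map (λ T → indicator (v ∈? T) w) Ts)) → Feasible G (uniform Ts w)
    uniform-feasible {Ts} {w} independent w≥0 covers =
      (λ I → vanishes independent) ,
      (λ I → ℚP.≤-trans (ℚP.≤-reflexive (sym (sumℚ-map-0 Ts))) (sumℚ-map-mono Ts (λ T → indicator-nonNeg (T ≟ˢ I) w≥0))) ,
      (λ v → ℚP.≤-trans (covers v) (ℚP.≤-reflexive (sym (coverage-uniform Ts w v))))
      where
      vanishes : ∀ {Ts I} → All (Independent G) Ts → ¬ Independent G I → uniform Ts w I ≡ 0ℚ
      vanishes []                 _ = refl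
      vanishes {T ∷ Ts} {I} (iT ∷ iTs) ¬iI with T ≟ˢ I
      ... | yes refl = ⊥-elim (¬iI iT)
      ... | no  _    = trans (ℚP.+-identityˡ _) (vanishes iTs ¬iI)

    meets : ∀ {m} → (Fin m → Fin n) → Subset n → ℕ
    meets c I = sum (λ i → if does (c i ∈? I) then 1 else 0)

    independent-meets-oddCycle : ∀ k {c} → IsCycle G (k ℕ.+ k) c → ∀ {I} → Independent G I → meets c I ℕ.≤ k
    independent-meets-oddCycle k {c} (_ , _ , steps , closing) {I} independent =
      half-≤ (meets c I) k (cyclic-∑-≤ (k ℕ.+ k) (λ i → if does (c i ∈? I) then 1 else 0)
                                        (λ i → not-both (steps i)) (not-both closing))
      where
      not-both : ∀ {u v} → adj G u v ≡ true → (if does (u ∈? I) then 1 else 0) ℕ.+ (if does (v ∈? I) then 1 else 0) ℕ.≤ 1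
      not-both {u} {v} e with u ∈? I | v ∈? I
      ... | yes u∈I | yes v∈I = ⊥-elim (independent⇒¬adj G independent u∈I v∈I e)
      ... | yes _   | no _    = ℕP.≤-refl
      ... | no _    | yes _   = ℕP.≤-refl
      ... | no _    | no _    = z≤n

    oddCycle⇒size≤k·objective : ∀ k {c} → IsCycle G (k ℕ.+ k) c → ∀ {y} → Feasible G y →
      suc (k ℕ.+ k) · 1ℚ ≤ k · objective y
    oddCycle⇒size≤k·objective k {c} cycle {y} (vanishes , y≥0 , covers) = begin
      suc (k ℕ.+ k) · 1ℚ
        ≡⟨ cong (_· 1ℚ) (ListP.length-tabulate c) ⟨
      length (List.tabulate c) · 1ℚ
        ≡⟨ sumℚ-map-const (List.tabulate c) 1ℚ ⟨
      sumℚ (map (λ _ → 1ℚ) (List.tabulate c))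
        ≤⟨ sumℚ-map-mono (List.tabulate c) covers ⟩
      sumℚ (map (coverage y) (List.tabulate c))
        ≡⟨ sumℚ-map-comm (List.tabulate c) subsets (λ v I → indicator (v ∈? I) (y I)) ⟩
      sumℚ (map (λ I → sumℚ (map (λ v → indicator (v ∈? I) (y I)) (List.tabulate c))) subsets)
        ≡⟨ sumℚ-map-cong subsets (λ I → sumℚ-map-tabulate-if c (λ v → does (v ∈? I)) (y I)) ⟩
      sumℚ (map (λ I → meets c I · y I) subsets)
        ≤⟨ sumℚ-map-mono subsets bounded ⟩
      sumℚ (map (λ I → k · y I) subsets)
        ≡⟨ sumℚ-map-· subsets k y ⟩
      k · objective y ∎
      where
      open ℚP.≤-Reasoning
      bounded : ∀ I → meets c I · y I ≤ k · y I
      bounded I with meets c I ℕ.≤? k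
      ... | yes meets≤k = ·-monoˡ-≤ (y≥0 I) meets≤k
      ... | no  meets≰k rewrite vanishes I (meets≰k ∘ independent-meets-oddCycle k cycle) =
        ℚP.≤-reflexive (trans (·-zeroʳ (meets c I)) (sym (·-zeroʳ k)))

    oddCycle⇒lowerBound : ∀ k .{{_ : NonZero k}} {c} → IsCycle G (k ℕ.+ k) c →
      ∀ y → Feasible G y → (+ 2 / 1) + (+ 1 / k) ≤ objective y
    oddCycle⇒lowerBound k cycle y feasible =
      subst (_≤ objective y) (oddCycle-value k)
        (·-≤-divide {k = k} {m = suc (k ℕ.+ k)} (1/n-nonNeg k) (·-inverse k) (oddCycle⇒size≤k·objective k cycle feasible))

  subset : ∀ {n} {P : Pred (Fin n) 0ℓ} → Decidable P → Subset n
  subset P? = tabulate (does ∘ P?)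

  does-∈-subset : ∀ {n} {P : Pred (Fin n) 0ℓ} (P? : Decidable P) u → does (u ∈? subset P?) ≡ does (P? u)
  does-∈-subset P? zero with does (P? zero)
  ... | true  = refl
  ... | false = refl
  does-∈-subset P? (suc u) = does-∈-subset (P? ∘ suc) u

  ∈-subset⁻ : ∀ {n} {P : Pred (Fin n) 0ℓ} (P? : Decidable P) {u} → u ∈ subset P? → P u
  ∈-subset⁻ P? {u} u∈ with P? u | trans (sym (does-∈-subset P? u)) (dec-true (u ∈? subset P?) u∈)
  ... | yes p | _  = p
  ... | no _  | ()

  preimage-independent : ∀ {n} (G : Graph n) {A : Set} {R : A → A → Set} {Q : Pred A 0ℓ} (f : Fin n → A) (Q? : Decidable Q) →
    (∀ {u v} → adj G u v ≡ true → R (f u) (f v)) → (∀ {a b} → R a b → Q a → Q b → ⊥) → Independent G (subset (Q? ∘ f))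
  preimage-independent G f Q? hom independent u v u∈ v∈ with adj G u v in e
  ... | true  = ⊥-elim (independent (hom e) (∈-subset⁻ (Q? ∘ f) u∈) (∈-subset⁻ (Q? ∘ f) v∈))
  ... | false = refl

  module _ {n} (G : Graph n) (k : ℕ) .{{_ : NonZero k}} (position : Fin n → Position)
    (position-adjacent : ∀ {u v} → adj G u v ≡ true → Adjacent k (position u) (position v)) where

    private
      w = + 1 / k

      Earc Oarc : ℕ → Subset n
      Earc i = subset (λ u → position u ∈E? i)
      Oarc i = subset (λ u → position u ∈O? i)

    arcs : List (Subset n)
    arcs = map Earc (upTo (suc k)) ++ map Oarc (upTo k)

    arcs-independent : All (Independent G) arcs
    arcs-independent =
      ++⁺ (map⁺ (universal (λ i → preimage-independent G position (_∈E? i) position-adjacent E-independent) _))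
          (map⁺ (applyUpTo⁺₁ _ k (λ i<k → preimage-independent G position (_∈O? _) position-adjacent (O-independent i<k))))

    arcs-length : length arcs ≡ suc (k ℕ.+ k)
    arcs-length = begin
      length arcs
        ≡⟨ ListP.length-++ (map Earc (upTo (suc k))) ⟩
      length (map Earc (upTo (suc k))) ℕ.+ length (map Oarc (upTo k))
        ≡⟨ cong₂ ℕ._+_ (ListP.length-map Earc (upTo (suc k))) (ListP.length-map Oarc (upTo k)) ⟩
      length (upTo (suc k)) ℕ.+ length (upTo k)
        ≡⟨ cong₂ ℕ._+_ (ListP.length-upTo (suc k)) (ListP.length-upTo k) ⟩
      suc k ℕ.+ k ∎
      where open ≡-Reasoning

    arcs-cover : ∀ v → 1ℚ ≤ sumℚ (map (λ T → indicator (v ∈? T) w) arcs)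
    arcs-cover v = begin
      1ℚ
        ≡⟨ ·-inverse k ⟨
      k · w
        ≤⟨ arc-coverage k (1/n-nonNeg k) (position v) ⟩
      sumℚ (map (λ i → indicator (position v ∈E? i) w) (upTo (suc k))) + sumℚ (map (λ i → indicator (position v ∈O? i) w) (upTo k))
        ≡⟨ cong₂ _+_ (sumℚ-map-cong (upTo (suc k)) (λ i → indicator-∈-subset (λ u → position u ∈E? i)))
                     (sumℚ-map-cong (upTo k) (λ i → indicator-∈-subset (λ u → position u ∈O? i))) ⟨
      sumℚ (map (g ∘ Earc) (upTo (suc k))) + sumℚ (map (g ∘ Oarc) (upTo k))
        ≡⟨ cong₂ (λ xs ys → sumℚ xs + sumℚ ys) (ListP.map-∘ {g = g} {f = Earc} (upTo (suc k))) (ListP.map-∘ {g = g} {f = Oarc} (upTo k)) ⟩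
      sumℚ (map g (map Earc (upTo (suc k)))) + sumℚ (map g (map Oarc (upTo k)))
        ≡⟨ sumℚ-++ (map g (map Earc (upTo (suc k)))) _ ⟨
      sumℚ (map g (map Earc (upTo (suc k))) ++ map g (map Oarc (upTo k)))
        ≡⟨ cong sumℚ (ListP.map-++ g (map Earc (upTo (suc k))) (map Oarc (upTo k))) ⟨
      sumℚ (map g arcs) ∎
      where
      open ℚP.≤-Reasoning
      g : Subset n → ℚ
      g T = indicator (v ∈? T) w
      indicator-∈-subset : ∀ {P : Pred (Fin n) 0ℓ} (P? : Decidable P) → g (subset P?) ≡ indicator (P? v) w
      indicator-∈-subset P? = cong (λ b → if b then w else 0ℚ) (does-∈-subset P? v)

    homomorphism⇒upperBound : Σ _ λ y → Feasible G y × objective y ≡ (+ 2 / 1) + w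
    homomorphism⇒upperBound =
      uniform G arcs w ,
      uniform-feasible G arcs-independent (1/n-nonNeg k) arcs-cover ,
      trans (objective-uniform G arcs w) (trans (cong (_· w) arcs-length) (oddCycle-value k))

open import Defs
open import Data.Nat using (ℕ; suc; _*_; _∸_; NonZero)
open import Data.Fin using (Fin)
open import Data.Integer using (+_)
open import Data.Rational using (_+_; _/_)
open import Relation.Nullary using (¬_)
import Data.Nat as ℕ
open import Data.Nat.Tactic.RingSolver using (solve-∀)
open import Data.Empty using (⊥-elim-irr)
open import Data.Product using (_,_)
open import Relation.Binary.PropositionalEquality using (_≡_; subst)
open OddClosedWalks using (oddClosedWalk-≥)
open HomomorphismToOddCycle using (module Homomorphism)
open FractionalColouring using (homomorphism⇒upperBound; oddCycle⇒lowerBound)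

mainTheorem16 : ∀ {n} (G : Graph (suc n)) (vp : Fin (suc n)) →
    ¬ Bipartite G → Bipartite (deleteVertex G vp) →
    (ρ : ℕ) → .{{_ : NonZero (ρ ∸ 1)}} → IsOddGirth G (2 * ρ ∸ 1) →
    IsFracChromaticNumber G ((+ 2 / 1) + (+ 1 / (ρ ∸ 1)))
mainTheorem16 G vp _ _ 0 {{ρ∸1≢0}} _ = ⊥-elim-irr (NonZero.nonZero ρ∸1≢0)
mainTheorem16 G vp _ _ 1 {{ρ∸1≢0}} _ = ⊥-elim-irr (NonZero.nonZero ρ∸1≢0)
mainTheorem16 G vp _ (col , col-proper) (suc (suc j)) oddGirth
  with subst (IsOddGirth G) (2ρ∸1≡2k+1 j) oddGirth
  where
  2ρ∸1≡2k+1 : ∀ j → suc j ℕ.+ (suc (suc j) ℕ.+ 0) ≡ suc (suc j ℕ.+ suc j)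
  2ρ∸1≡2k+1 = solve-∀
... | (_ , _ , shortestCycle) , shortest =
  homomorphism⇒upperBound G (suc j) position position-adjacent ,
  oddCycle⇒lowerBound G (suc j) shortestCycle
  where
  open Homomorphism G vp col col-proper j (oddClosedWalk-≥ shortest)
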